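{- Let $f:\mathbb{Z}_{>0}\to\mathbb{Q}_{>0}$ be defined by $f(2^k\ell)=\ell^{1-k}$ for all nonnegative integers $k,\ell$ with $\ell$ odd. Let $n$ be a positive integer. Then $\prod_{r=1}^{n} f(r)$ is an integer multiple of $\mathrm{odd}(\mathrm{lcm}(1,2,\dots,n))$. In particular, $\prod_{r=1}^{n} f(r)$ is a multiple of every odd prime number not exceeding $n$.
   Context: For a positive rational number $\alpha$, its odd part $\mathrm{odd}(\alpha)$ is the positive rational number such that $\alpha=2^{v_2(\alpha)}\cdot\mathrm{odd}(\alpha)$, where $v_2$ is the $2$-adic valuation. -}

module Defs where

open import Data.Nat as ℕ using (ℕ; zero; suc; _^_; NonZero)
open import Data.Nat.Properties using (m^n≢0)
open import Data.Nat.Divisibility using (_∣?_)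
open import Data.Nat.DivMod using (_/_)
open import Data.Nat.LCM using (lcm)
open import Data.Integer using (+_)
open import Data.Rational as ℚ using (ℚ; 1ℚ)
open import Data.List using (List; map; foldr; upTo)
open import Relation.Nullary using (yes; no)

ℕ→ℚ : ℕ → ℚ
ℕ→ℚ ℓ = (+ ℓ) ℚ./ 1

-- ℓ ^ (1 - k) for an integer exponent 1 - k, with ℓ a positive natural.
-- For k = 0 this is ℓ; for k = suc j it is 1 / ℓ ^ j.
-- (ℓ = 0 gets a junk value; it never occurs since ℓ is odd.)
pow1-k : ℕ → ℕ → ℚ
pow1-k ℓ zero = ℕ→ℚ ℓ
pow1-k zero (suc j) = 1ℚ
pow1-k (suc m) (suc j) = (+ 1) ℚ./ (suc m ^ j)
  where instance _ = m^n≢0 (suc m) j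

prodℚ : List ℚ → ℚ
prodℚ = foldr ℚ._*_ 1ℚ

prodUpTo : (ℕ → ℚ) → ℕ → ℚ
prodUpTo f n = prodℚ (map (λ i → f (suc i)) (upTo n))

lcmUpTo : ℕ → ℕ
lcmUpTo n = foldr lcm 1 (map suc (upTo n))

-- odd part of a positive natural: strip factors of 2 (fuel-bounded; fuel = n suffices).
oddPartAux : ℕ → ℕ → ℕ
oddPartAux zero n = n
oddPartAux (suc fuel) zero = zero
oddPartAux (suc fuel) (suc m) with 2 ∣? suc m
... | yes _ = oddPartAux fuel (suc m / 2)
... | no _ = suc m

oddPart : ℕ → ℕ
oddPart n = oddPartAux n n

module Submission where

-- Write r = 2^k ℓ with ℓ odd. Then f r = num r / den r with natural numbers
-- num r = (ℓ if k = 0, else 1) and den r = ℓ^(k-1), so ∏_{r≤n} f r = Num n / Den n,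
-- where Num and Den are the products of num and den over 1 ≤ r ≤ n and Den n is odd.
-- The heart of the proof is the divisibility
--     k · Den n ∣ Num n    for every odd k with 1 ≤ k ≤ n,                        (★)
-- checked one prime q at a time. For odd q, v_q(Num n) = α n and v_q(Den n) = β n are
-- sums over r ≤ n of v_q(odd part of r), weighted by [k = 0] and by k - 1. Only
-- multiples r = q s contribute, which yields the recurrences
--     α n = oddCount ⌊n/q⌋ + α ⌊n/q⌋,    β n = excess ⌊n/q⌋ + β ⌊n/q⌋,
-- where oddCount m counts the odd numbers ≤ m and excess m = Σ_{s≤m} (v₂ s - 1)₊.
-- A 2-adic count gives excess m < oddCount m for m ≥ 1, hence t + β n ≤ α n whenever
-- q^t ≤ n, which is (★) at q.
-- Taking k = 1 the product is a natural number N n; by (★) every odd k ≤ n divides it,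
-- so lcm(1,…,n) divides 2^n · N n and its odd part divides N n.

open import Defs
open import Data.Nat using (ℕ; _^_; _*_; _≤_)
open import Data.Nat.Divisibility using (_∣_)
open import Data.Nat.Primality using (Prime)
open import Data.Integer using (ℤ)
open import Data.Rational as ℚ using (ℚ; 1ℚ; toℚᵘ)
open import Data.Product using (_×_; ∃-syntax)
open import Relation.Nullary using (¬_)
open import Relation.Binary.PropositionalEquality using (_≡_; _≢_)

open import Data.Nat as ℕ using (zero; suc; _+_; _∸_; _<_; z≤n; s≤s; NonZero; >-nonZero; _/_; _%_)
open import Data.Nat.Properties
open import Data.Nat.Divisibility
open import Data.Nat.DivMod using (m≡m%n+[m/n]*n; m%n<n; m*n/n≡m; /-monoˡ-≤; m/n<m; m*[n/m]≡n)
open import Data.Nat.Primality using (prime; prime[2]; euclidsLemma; prime⇒irreducible)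
open import Data.Nat.Primality.Factorisation using (factorise)
open import Data.Nat.Coprimality using (Coprime; coprime-divisor)
open import Data.Nat.LCM using (lcm; lcm-least)
import Data.Integer as ℤ
open import Data.Integer.Properties using (pos-*)
open import Data.Rational.Properties as ℚP using (toℚᵘ-injective; fromℚᵘ-cong; toℚᵘ-homo-*; toℚᵘ-fromℚᵘ)
open import Data.Rational.Unnormalised as ℚᵘ using (mkℚᵘ; *≡*)
import Data.Rational.Unnormalised.Properties as ℚᵘP
import Algebra.Properties.CommutativeSemigroup as CommSemigroupProps
open import Data.List using ([]; _∷_; map; foldr; upTo; _∷ʳ_)
open import Data.List.Properties using (upTo-∷ʳ; foldr-∷ʳ; map-++)
open import Data.List.Membership.Propositional using (_∈_)
open import Data.List.Membership.Propositional.Properties using (∈-map⁻; ∈-upTo⁻)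
open import Data.List.Relation.Unary.Any using (here; there)
open import Data.List.Relation.Unary.All using (_∷_)
open import Data.Product using (_,_; proj₁; proj₂)
open import Data.Sum using (inj₁; inj₂)
open import Data.Empty using (⊥-elim)
open import Relation.Nullary using (yes; no)
open import Data.Nat.Induction using (<-rec)
open import Relation.Binary.PropositionalEquality using (refl; sym; trans; cong; cong₂; subst; subst₂; module ≡-Reasoning)

open CommSemigroupProps *-commutativeSemigroup using () renaming (x∙yz≈y∙xz to *-leftComm)
open CommSemigroupProps +-commutativeSemigroup using () renaming (x∙yz≈y∙xz to +-leftComm; interchange to +-interchange)

2≤⇒nonZero : ∀ {p} → 2 ≤ p → NonZero p
2≤⇒nonZero (s≤s _) = _

1≤^ : ∀ x e → 1 ≤ x → 1 ≤ x ^ e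
1≤^ x e 1≤x = m^n>0 x {{>-nonZero 1≤x}} e

≥2∤1 : ∀ {p} → 2 ≤ p → ¬ p ∣ 1
≥2∤1 2≤p p∣1 with ∣1⇒≡1 p∣1
≥2∤1 (s≤s ()) p∣1 | refl

∤⇒1≤ : ∀ {p w} → ¬ p ∣ w → 1 ≤ w
∤⇒1≤ {p} {zero} p∤0 = ⊥-elim (p∤0 (p ∣0))
∤⇒1≤ {w = suc w} _ = s≤s z≤n

prime⇒2≤ : ∀ {p} → Prime p → 2 ≤ p
prime⇒2≤ {p} (prime {{nt}} _) = ℕ.nonTrivial⇒n>1 p {{nt}}

odd-prime : ∀ {p} → Prime p → p ≢ 2 → ¬ 2 ∣ p
odd-prime pr p≢2 2∣p with prime⇒irreducible pr 2∣p
... | inj₂ p≡2 = p≢2 (sym p≡2)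

2≤2 : 2 ≤ 2
2≤2 = s≤s (s≤s z≤n)

^-suc-* : ∀ p a w → p ^ suc a * w ≡ p * (p ^ a * w)
^-suc-* p a w = *-assoc p (p ^ a) w

^-mono-∣ : ∀ p {s t} → s ≤ t → p ^ s ∣ p ^ t
^-mono-∣ p {s} {t} s≤t = divides (p ^ (t ∸ s))
  (trans (cong (p ^_) (sym (m∸n+n≡m s≤t))) (^-distribˡ-+-* p (t ∸ s) s))

n<2^n : ∀ n → n < 2 ^ n
n<2^n zero = s≤s z≤n
n<2^n (suc n) = subst (_≤ 2 ^ suc n) (+-comm (suc n) 1)
  (+-mono-≤ (n<2^n n) (subst (1 ≤_) (sym (+-identityʳ (2 ^ n))) (1≤^ 2 n (s≤s z≤n))))

-- The p-adic valuation for a base p ≥ 2: every x ≥ 1 is p ^ val p x * cofactor p x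
-- with p ∤ cofactor p x.
opaque
  strip : ℕ → ℕ → ℕ → ℕ × ℕ
  strip p zero x = 0 , x
  strip p (suc fuel) x with p ∣? x
  ... | yes (divides q _) = suc (proj₁ (strip p fuel q)) , proj₂ (strip p fuel q)
  ... | no _ = 0 , x

  strip-decomp : ∀ p fuel x → 2 ≤ p → 1 ≤ x → x ≤ fuel →
    x ≡ p ^ proj₁ (strip p fuel x) * proj₂ (strip p fuel x) × ¬ p ∣ proj₂ (strip p fuel x)
  strip-decomp p zero x 2≤p 1≤x x≤0 with ≤-antisym (≤-trans 1≤x x≤0) z≤n
  ... | ()
  strip-decomp p (suc fuel) x 2≤p 1≤x x≤fuel with p ∣? x
  ... | no p∤x = sym (*-identityˡ x) , p∤x
  ... | yes (divides zero x≡0) = ⊥-elim (<⇒≢ (≤-trans 1≤x (≤-reflexive x≡0)) refl)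
  ... | yes (divides q@(suc _) x≡qp) = x≡ , proj₂ ih
    where
    q<x : q < x
    q<x = subst (q <_) (sym x≡qp) (subst (_< q * p) (*-identityʳ q) (*-monoʳ-< q 2≤p))
    ih : q ≡ p ^ proj₁ (strip p fuel q) * proj₂ (strip p fuel q) × ¬ p ∣ proj₂ (strip p fuel q)
    ih = strip-decomp p fuel q 2≤p (s≤s z≤n) (≤-pred (≤-trans q<x x≤fuel))
    x≡ : x ≡ p ^ suc (proj₁ (strip p fuel q)) * proj₂ (strip p fuel q)
    x≡ = trans x≡qp (trans (*-comm q p) (trans (cong (p *_) (proj₁ ih)) (sym (^-suc-* p (proj₁ (strip p fuel q)) (proj₂ (strip p fuel q))))))

  val cofactor : ℕ → ℕ → ℕ
  val p x = proj₁ (strip p x x)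
  cofactor p x = proj₂ (strip p x x)

  val-decomp : ∀ {p x} → 2 ≤ p → 1 ≤ x → x ≡ p ^ val p x * cofactor p x
  val-decomp {p} {x} 2≤p 1≤x = proj₁ (strip-decomp p x x 2≤p 1≤x ≤-refl)

  cofactor-∤ : ∀ {p x} → 2 ≤ p → 1 ≤ x → ¬ p ∣ cofactor p x
  cofactor-∤ {p} {x} 2≤p 1≤x = proj₂ (strip-decomp p x x 2≤p 1≤x ≤-refl)

decomp-unique : ∀ {p w w'} a b → 2 ≤ p → ¬ p ∣ w → ¬ p ∣ w' →
  p ^ a * w ≡ p ^ b * w' → a ≡ b × w ≡ w'
decomp-unique zero zero _ _ _ eq = refl , trans (sym (*-identityˡ _)) (trans eq (*-identityˡ _))
decomp-unique {p} {w} {w'} zero (suc b) _ p∤w _ eq =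
  ⊥-elim (p∤w (divides (p ^ b * w') (trans (sym (*-identityˡ w)) (trans eq (trans (^-suc-* p b w') (*-comm p _))))))
decomp-unique {p} {w} {w'} (suc a) zero _ _ p∤w' eq =
  ⊥-elim (p∤w' (divides (p ^ a * w) (trans (sym (*-identityˡ w')) (trans (sym eq) (trans (^-suc-* p a w) (*-comm p _))))))
decomp-unique {p} {w} {w'} (suc a) (suc b) 2≤p p∤w p∤w' eq
  with decomp-unique a b 2≤p p∤w p∤w'
         (*-cancelˡ-≡ (p ^ a * w) (p ^ b * w') p {{2≤⇒nonZero 2≤p}} (trans (sym (^-suc-* p a w)) (trans eq (^-suc-* p b w'))))
... | refl , w≡w' = refl , w≡w'

val-char : ∀ {p x w} a → 2 ≤ p → ¬ p ∣ w → x ≡ p ^ a * w → val p x ≡ a × cofactor p x ≡ w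
val-char {p} {x} {w} a 2≤p p∤w x≡ =
  let a≡ , w≡ = decomp-unique a (val p x) 2≤p p∤w (cofactor-∤ 2≤p 1≤x) (trans (sym x≡) (val-decomp 2≤p 1≤x))
  in sym a≡ , sym w≡
  where
  1≤x : 1 ≤ x
  1≤x = subst (1 ≤_) (sym x≡) (*-mono-≤ (1≤^ p a (≤-trans (s≤s z≤n) 2≤p)) (∤⇒1≤ p∤w))

val-∤ : ∀ {p x} → 2 ≤ p → ¬ p ∣ x → val p x ≡ 0
val-∤ {p} {x} 2≤p p∤x = proj₁ (val-char 0 2≤p p∤x (sym (*-identityˡ x)))

val-1 : ∀ {p} → 2 ≤ p → val p 1 ≡ 0
val-1 2≤p = val-∤ 2≤p (≥2∤1 2≤p)

val-p* : ∀ {p s} → 2 ≤ p → 1 ≤ s → val p (p * s) ≡ suc (val p s) × cofactor p (p * s) ≡ cofactor p s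
val-p* {p} {s} 2≤p 1≤s = val-char (suc (val p s)) 2≤p (cofactor-∤ 2≤p 1≤s)
  (trans (cong (p *_) (val-decomp 2≤p 1≤s)) (sym (^-suc-* p (val p s) (cofactor p s))))

^-*-collect : ∀ p a b w w' → (p ^ a * w) * (p ^ b * w') ≡ p ^ (a + b) * (w * w')
^-*-collect p a b w w' = begin
  (p ^ a * w) * (p ^ b * w')   ≡⟨ *-assoc (p ^ a) w (p ^ b * w') ⟩
  p ^ a * (w * (p ^ b * w'))   ≡⟨ cong (p ^ a *_) (*-leftComm w (p ^ b) w') ⟩
  p ^ a * (p ^ b * (w * w'))   ≡⟨ *-assoc (p ^ a) (p ^ b) (w * w') ⟨
  (p ^ a * p ^ b) * (w * w')   ≡⟨ cong (_* (w * w')) (^-distribˡ-+-* p a b) ⟨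
  p ^ (a + b) * (w * w')       ∎
  where open ≡-Reasoning

val-* : ∀ {p x y} → Prime p → 1 ≤ x → 1 ≤ y →
  val p (x * y) ≡ val p x + val p y × cofactor p (x * y) ≡ cofactor p x * cofactor p y
val-* {p} {x} {y} pr 1≤x 1≤y = val-char (val p x + val p y) 2≤p p∤ww'
    (trans (cong₂ _*_ (val-decomp 2≤p 1≤x) (val-decomp 2≤p 1≤y)) (^-*-collect p (val p x) (val p y) (cofactor p x) (cofactor p y)))
  where
  2≤p = prime⇒2≤ pr
  p∤ww' : ¬ p ∣ cofactor p x * cofactor p y
  p∤ww' p∣ww' with euclidsLemma (cofactor p x) (cofactor p y) pr p∣ww'
  ... | inj₁ p∣w = cofactor-∤ 2≤p 1≤x p∣w
  ... | inj₂ p∣w' = cofactor-∤ 2≤p 1≤y p∣w'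

^val∣ : ∀ {p x} → 2 ≤ p → 1 ≤ x → p ^ val p x ∣ x
^val∣ {p} {x} 2≤p 1≤x = divides (cofactor p x) (trans (val-decomp 2≤p 1≤x) (*-comm (p ^ val p x) (cofactor p x)))

cofactor∣ : ∀ {p x} → 2 ≤ p → 1 ≤ x → cofactor p x ∣ x
cofactor∣ {p} {x} 2≤p 1≤x = divides (p ^ val p x) (val-decomp 2≤p 1≤x)

1≤cofactor : ∀ {p x} → 2 ≤ p → 1 ≤ x → 1 ≤ cofactor p x
1≤cofactor 2≤p 1≤x = ∤⇒1≤ (cofactor-∤ 2≤p 1≤x)

^∣⇒≤val : ∀ {p x} s → 2 ≤ p → 1 ≤ x → p ^ s ∣ x → s ≤ val p x
^∣⇒≤val {p} {x} s 2≤p 1≤x p^s∣x with s ≤? val p x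
... | yes s≤v = s≤v
... | no s≰v = ⊥-elim (cofactor-∤ 2≤p 1≤x (*-cancelˡ-∣ (p ^ v) {{m^n≢0 p v {{2≤⇒nonZero 2≤p}}}} p^v*p∣))
  where
  v = val p x
  p^v*p∣ : p ^ v * p ∣ p ^ v * cofactor p x
  p^v*p∣ = subst₂ _∣_ (trans (^-distribˡ-+-* p v 1) (cong (p ^ v *_) (*-identityʳ p))) (val-decomp 2≤p 1≤x)
    (∣-trans (^-mono-∣ p (subst (_≤ s) (+-comm 1 v) (≰⇒> s≰v))) p^s∣x)

sumTo : ℕ → (ℕ → ℕ) → ℕ
sumTo zero g = 0
sumTo (suc n) g = sumTo n g + g (suc n)

sumTo-cong : ∀ n {g h} → (∀ r → 1 ≤ r → g r ≡ h r) → sumTo n g ≡ sumTo n h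
sumTo-cong zero g≡h = refl
sumTo-cong (suc n) g≡h = cong₂ _+_ (sumTo-cong n g≡h) (g≡h (suc n) (s≤s z≤n))

sumTo-+ : ∀ n g h → sumTo n (λ r → g r + h r) ≡ sumTo n g + sumTo n h
sumTo-+ zero g h = refl
sumTo-+ (suc n) g h = trans (cong (_+ (g (suc n) + h (suc n))) (sumTo-+ n g h))
  (+-interchange (sumTo n g) (sumTo n h) (g (suc n)) (h (suc n)))

module MultiplesOf (d : ℕ) .{{_ : NonZero d}} (g : ℕ → ℕ) (g-vanishes : ∀ r → 1 ≤ r → ¬ d ∣ r → g r ≡ 0) where

  sum-tail : ∀ m ρ → ρ < d → sumTo (m * d + ρ) g ≡ sumTo (m * d) g
  sum-tail m zero _ = cong (λ x → sumTo x g) (+-identityʳ (m * d))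
  sum-tail m (suc ρ) 1+ρ<d = begin
    sumTo (m * d + suc ρ) g                  ≡⟨ cong (λ x → sumTo x g) (+-suc (m * d) ρ) ⟩
    sumTo (m * d + ρ) g + g (suc (m * d + ρ)) ≡⟨ cong (sumTo (m * d + ρ) g +_) (g-vanishes _ (s≤s z≤n) d∤) ⟩
    sumTo (m * d + ρ) g + 0                  ≡⟨ +-identityʳ _ ⟩
    sumTo (m * d + ρ) g                      ≡⟨ sum-tail m ρ (≤-trans (n≤1+n _) 1+ρ<d) ⟩
    sumTo (m * d) g                          ∎
    where
    open ≡-Reasoning
    d∤ : ¬ d ∣ suc (m * d + ρ)
    d∤ d∣ = <⇒≱ 1+ρ<d (∣⇒≤ (∣m+n∣m⇒∣n (subst (d ∣_) (sym (+-suc (m * d) ρ)) d∣) (n∣m*n m)))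

  sum-blocks : ∀ m → sumTo (m * d) g ≡ sumTo m (λ s → g (d * s))
  sum-blocks zero = refl
  sum-blocks (suc m) = begin
    sumTo (suc m * d) g                         ≡⟨ cong (λ x → sumTo x g) split ⟩
    sumTo (m * d + d') g + g (suc (m * d + d')) ≡⟨ cong₂ _+_ (sum-tail m d' d'<d) (cong g (trans (sym split) (*-comm (suc m) d))) ⟩
    sumTo (m * d) g + g (d * suc m)             ≡⟨ cong (_+ g (d * suc m)) (sum-blocks m) ⟩
    sumTo (suc m) (λ s → g (d * s))             ∎
    where
    open ≡-Reasoning
    d' = ℕ.pred d
    d'<d : d' < d
    d'<d = subst (d' <_) (suc-pred d) ≤-refl
    split : suc m * d ≡ suc (m * d + d')
    split = trans (+-comm d (m * d)) (trans (cong (m * d +_) (sym (suc-pred d))) (+-suc (m * d) d'))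

  sum-multiples : ∀ n → sumTo n g ≡ sumTo (n / d) (λ s → g (d * s))
  sum-multiples n = begin
    sumTo n g                   ≡⟨ cong (λ x → sumTo x g) (trans (m≡m%n+[m/n]*n n d) (+-comm (n % d) _)) ⟩
    sumTo (n / d * d + n % d) g ≡⟨ sum-tail (n / d) (n % d) (m%n<n n d) ⟩
    sumTo (n / d * d) g         ≡⟨ sum-blocks (n / d) ⟩
    sumTo (n / d) (λ s → g (d * s)) ∎
    where open ≡-Reasoning

v₂ odd₂ : ℕ → ℕ
v₂ = val 2
odd₂ = cofactor 2

1≤odd₂ : ∀ {r} → 1 ≤ r → 1 ≤ odd₂ r
1≤odd₂ = 1≤cofactor 2≤2

2∤2j+1 : ∀ j → ¬ 2 ∣ suc (j + j)
2∤2j+1 j 2∣ = ≥2∤1 2≤2 (∣m+n∣m⇒∣n (subst (2 ∣_) (trans (cong (λ x → suc (j + x)) (sym (+-identityʳ j))) (+-comm 1 (2 * j))) 2∣) (divides j (*-comm 2 j)))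

v₂-odd : ∀ j → v₂ (suc (j + j)) ≡ 0
v₂-odd j = val-∤ 2≤2 (2∤2j+1 j)

v₂-even : ∀ j → v₂ (suc (suc (j + j))) ≡ suc (v₂ (suc j))
v₂-even j = trans (cong v₂ 2j+2≡) (proj₁ (val-p* {2} {suc j} 2≤2 (s≤s z≤n)))
  where
  2j+2≡ : suc (suc (j + j)) ≡ 2 * suc j
  2j+2≡ = cong suc (trans (sym (+-suc j j)) (cong (j +_) (sym (+-identityʳ (suc j)))))

-- ifZero k y is y when k = 0 and 0 otherwise; with k = v₂ s it keeps y only for odd s.
ifZero : ℕ → ℕ → ℕ
ifZero zero y = y
ifZero (suc _) y = 0

oddCount excess v₂-sum : ℕ → ℕ
oddCount m = sumTo m (λ s → ifZero (v₂ s) 1)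
excess m = sumTo m (λ s → v₂ s ∸ 1)
v₂-sum m = sumTo m v₂

-- The values at m = 2j and m = 2j+1: oddCount m = o, excess m = v₂-sum j, and
-- v₂-sum m = j + v₂-sum j (Legendre's halving step).
Counts : ℕ → ℕ → ℕ → Set
Counts m o j = oddCount m ≡ o × excess m ≡ v₂-sum j × v₂-sum m ≡ j + v₂-sum j

counts-even : ∀ j → Counts (j + j) j j
counts-odd : ∀ j → Counts (suc (j + j)) (suc j) j

counts-even zero = refl , refl , refl
counts-even (suc j) = subst (λ m → Counts m (suc j) (suc j)) (cong suc (sym (+-suc j j))) (o , e , v)
  where
  open ≡-Reasoning
  m = suc (j + j)
  ih = counts-odd j
  o : oddCount (suc m) ≡ suc j
  o = begin
    oddCount m + ifZero (v₂ (suc m)) 1 ≡⟨ cong₂ (λ a b → a + ifZero b 1) (proj₁ ih) (v₂-even j) ⟩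
    suc j + 0                          ≡⟨ +-identityʳ (suc j) ⟩
    suc j                              ∎
  e : excess (suc m) ≡ v₂-sum (suc j)
  e = cong₂ (λ a b → a + (b ∸ 1)) (proj₁ (proj₂ ih)) (v₂-even j)
  v : v₂-sum (suc m) ≡ suc j + v₂-sum (suc j)
  v = begin
    v₂-sum m + v₂ (suc m)                ≡⟨ cong₂ _+_ (proj₂ (proj₂ ih)) (v₂-even j) ⟩
    j + v₂-sum j + suc (v₂ (suc j))      ≡⟨ +-suc (j + v₂-sum j) (v₂ (suc j)) ⟩
    suc (j + v₂-sum j + v₂ (suc j))      ≡⟨ cong suc (+-assoc j (v₂-sum j) (v₂ (suc j))) ⟩
    suc j + v₂-sum (suc j)               ∎

counts-odd j = o , e , v
  where
  open ≡-Reasoning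
  ih = counts-even j
  o : oddCount (suc (j + j)) ≡ suc j
  o = begin
    oddCount (j + j) + ifZero (v₂ (suc (j + j))) 1 ≡⟨ cong₂ (λ a b → a + ifZero b 1) (proj₁ ih) (v₂-odd j) ⟩
    j + 1                                          ≡⟨ +-comm j 1 ⟩
    suc j                                          ∎
  e : excess (suc (j + j)) ≡ v₂-sum j
  e = trans (cong₂ (λ a b → a + (b ∸ 1)) (proj₁ (proj₂ ih)) (v₂-odd j)) (+-identityʳ (v₂-sum j))
  v : v₂-sum (suc (j + j)) ≡ j + v₂-sum j
  v = trans (cong₂ _+_ (proj₂ (proj₂ ih)) (v₂-odd j)) (+-identityʳ (j + v₂-sum j))

data Halves : ℕ → Set where
  even : ∀ j → Halves (j + j)
  odd  : ∀ j → Halves (suc (j + j))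

halves : ∀ m → Halves m
halves zero = even 0
halves (suc m) with halves m
... | even j = odd j
... | odd j = subst Halves (cong suc (+-suc j j)) (even (suc j))

-- v₂(m!) ≤ m - 1, by strong induction through the halving step.
v₂-sum≤ : ∀ m → v₂-sum m ≤ m ∸ 1
v₂-sum≤ = <-rec (λ m → v₂-sum m ≤ m ∸ 1) bound
  where
  bound : ∀ m → (∀ {j} → j < m → v₂-sum j ≤ j ∸ 1) → v₂-sum m ≤ m ∸ 1
  bound m ih with halves m
  ... | even zero = z≤n
  ... | even (suc j) = begin
    v₂-sum (suc j + suc j) ≡⟨ proj₂ (proj₂ (counts-even (suc j))) ⟩
    suc j + v₂-sum (suc j) ≤⟨ +-monoʳ-≤ (suc j) (ih (s≤s (m≤n+m (suc j) j))) ⟩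
    suc j + j              ≡⟨ +-suc j j ⟨
    j + suc j              ∎
    where open ≤-Reasoning
  ... | odd j = begin
    v₂-sum (suc (j + j)) ≡⟨ proj₂ (proj₂ (counts-odd j)) ⟩
    j + v₂-sum j         ≤⟨ +-monoʳ-≤ j (≤-trans (ih (s≤s (m≤m+n j j))) (m∸n≤m j 1)) ⟩
    j + j                ∎
    where open ≤-Reasoning

excess<oddCount : ∀ m → 1 ≤ m → excess m < oddCount m
excess<oddCount m 1≤m with halves m
excess<oddCount .(zero + zero) () | even zero
... | even (suc j) = subst₂ (λ e o → suc e ≤ o) (sym (proj₁ (proj₂ c))) (sym (proj₁ c)) (s≤s (v₂-sum≤ (suc j)))
  where c = counts-even (suc j)
... | odd j = subst₂ (λ e o → suc e ≤ o) (sym (proj₁ (proj₂ c))) (sym (proj₁ c)) (s≤s (≤-trans (v₂-sum≤ j) (m∸n≤m j 1)))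
  where c = counts-odd j

excess≤oddCount : ∀ m → excess m ≤ oddCount m
excess≤oddCount zero = z≤n
excess≤oddCount (suc m) = <⇒≤ (excess<oddCount (suc m) (s≤s z≤n))

ifZero-0 : ∀ k → ifZero k 0 ≡ 0
ifZero-0 zero = refl
ifZero-0 (suc k) = refl

ifZero-suc : ∀ k y → ifZero k (suc y) ≡ ifZero k 1 + ifZero k y
ifZero-suc zero y = refl
ifZero-suc (suc k) y = refl

numer : ℕ → ℕ → ℕ
numer zero ℓ = ℓ
numer (suc _) ℓ = 1

num den : ℕ → ℕ
num r = numer (v₂ r) (odd₂ r)
den r = odd₂ r ^ (v₂ r ∸ 1)

prodTo : ℕ → (ℕ → ℕ) → ℕ
prodTo zero g = 1
prodTo (suc n) g = prodTo n g * g (suc n)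

Num Den : ℕ → ℕ
Num n = prodTo n num
Den n = prodTo n den

1≤prodTo : ∀ n g → (∀ r → 1 ≤ r → 1 ≤ g r) → 1 ≤ prodTo n g
1≤prodTo zero g _ = ≤-refl
1≤prodTo (suc n) g 1≤g = *-mono-≤ (1≤prodTo n g 1≤g) (1≤g (suc n) (s≤s z≤n))

1≤numer : ∀ k ℓ → 1 ≤ ℓ → 1 ≤ numer k ℓ
1≤numer zero ℓ 1≤ℓ = 1≤ℓ
1≤numer (suc k) ℓ _ = ≤-refl

1≤num : ∀ r → 1 ≤ r → 1 ≤ num r
1≤num r 1≤r = 1≤numer (v₂ r) (odd₂ r) (1≤odd₂ 1≤r)

1≤den : ∀ r → 1 ≤ r → 1 ≤ den r
1≤den r 1≤r = 1≤^ (odd₂ r) (v₂ r ∸ 1) (1≤odd₂ 1≤r)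

1≤Num : ∀ n → 1 ≤ Num n
1≤Num n = 1≤prodTo n num 1≤num

1≤Den : ∀ n → 1 ≤ Den n
1≤Den n = 1≤prodTo n den 1≤den

prime∤prodTo : ∀ {p} n g → Prime p → (∀ r → 1 ≤ r → ¬ p ∣ g r) → ¬ p ∣ prodTo n g
prime∤prodTo zero g pr _ = ≥2∤1 (prime⇒2≤ pr)
prime∤prodTo (suc n) g pr p∤g p∣ with euclidsLemma (prodTo n g) (g (suc n)) pr p∣
... | inj₁ p∣prod = prime∤prodTo n g pr p∤g p∣prod
... | inj₂ p∣gn = p∤g (suc n) (s≤s z≤n) p∣gn

prime∤^ : ∀ {p} x e → Prime p → ¬ p ∣ x → ¬ p ∣ x ^ e
prime∤^ x zero pr _ = ≥2∤1 (prime⇒2≤ pr)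
prime∤^ x (suc e) pr p∤x p∣ with euclidsLemma x (x ^ e) pr p∣
... | inj₁ p∣x = p∤x p∣x
... | inj₂ p∣x^e = prime∤^ x e pr p∤x p∣x^e

Den-odd : ∀ n → ¬ 2 ∣ Den n
Den-odd n = prime∤prodTo n den prime[2] (λ r 1≤r → prime∤^ (odd₂ r) (v₂ r ∸ 1) prime[2] (cofactor-∤ 2≤2 1≤r))

module OddPrime (q : ℕ) (pr : Prime q) (q-odd : ¬ 2 ∣ q) where

  2≤q : 2 ≤ q
  2≤q = prime⇒2≤ pr

  instance
    q-nonZero : NonZero q
    q-nonZero = 2≤⇒nonZero 2≤q

  vq : ℕ → ℕ
  vq r = val q (odd₂ r)

  αterm βterm α β : ℕ → ℕ
  αterm r = ifZero (v₂ r) (vq r)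
  βterm r = (v₂ r ∸ 1) * vq r
  α n = sumTo n αterm
  β n = sumTo n βterm

  val-prodTo : ∀ n g h → (∀ r → 1 ≤ r → 1 ≤ g r) → (∀ r → 1 ≤ r → val q (g r) ≡ h r) →
    val q (prodTo n g) ≡ sumTo n h
  val-prodTo zero g h _ _ = val-1 2≤q
  val-prodTo (suc n) g h 1≤g val≡ = trans (proj₁ (val-* pr (1≤prodTo n g 1≤g) (1≤g (suc n) (s≤s z≤n))))
    (cong₂ _+_ (val-prodTo n g h 1≤g val≡) (val≡ (suc n) (s≤s z≤n)))

  val-^ : ∀ x e → 1 ≤ x → val q (x ^ e) ≡ e * val q x
  val-^ x zero _ = val-1 2≤q
  val-^ x (suc e) 1≤x = trans (proj₁ (val-* pr 1≤x (1≤^ x e 1≤x))) (cong (val q x +_) (val-^ x e 1≤x))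

  val-numer : ∀ k ℓ → val q (numer k ℓ) ≡ ifZero k (val q ℓ)
  val-numer zero ℓ = refl
  val-numer (suc k) ℓ = val-1 2≤q

  val-Num : ∀ n → val q (Num n) ≡ α n
  val-Num n = val-prodTo n num αterm 1≤num (λ r _ → val-numer (v₂ r) (odd₂ r))

  val-Den : ∀ n → val q (Den n) ≡ β n
  val-Den n = val-prodTo n den βterm 1≤den (λ r 1≤r → val-^ (odd₂ r) (v₂ r ∸ 1) (1≤odd₂ 1≤r))

  odd₂-q* : ∀ {s} → 1 ≤ s → v₂ (q * s) ≡ v₂ s × odd₂ (q * s) ≡ q * odd₂ s
  odd₂-q* {s} 1≤s = let v≡ , w≡ = val-* {2} {q} {s} prime[2] (≤-trans (s≤s z≤n) 2≤q) 1≤s in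
    trans v≡ (cong (_+ v₂ s) (val-∤ 2≤2 q-odd)) , trans w≡ (cong (_* odd₂ s) (proj₂ (val-char 0 2≤2 q-odd (sym (*-identityˡ q)))))

  vq-q* : ∀ {s} → 1 ≤ s → vq (q * s) ≡ suc (vq s)
  vq-q* 1≤s = trans (cong (val q) (proj₂ (odd₂-q* 1≤s))) (proj₁ (val-p* 2≤q (1≤odd₂ 1≤s)))

  vq-vanishes : ∀ {r} → 1 ≤ r → ¬ q ∣ r → vq r ≡ 0
  vq-vanishes 1≤r q∤r = val-∤ 2≤q (λ q∣odd → q∤r (∣-trans q∣odd (cofactor∣ 2≤2 1≤r)))

  -- Grouping the multiples r = q s: each contributes its own term plus one more
  -- unit of vq, which is counted by oddCount resp. excess.
  α-rec : ∀ n → α n ≡ oddCount (n / q) + α (n / q)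
  α-rec n = begin
    α n                                                   ≡⟨ MultiplesOf.sum-multiples q αterm αterm-vanishes n ⟩
    sumTo (n / q) (λ s → αterm (q * s))                   ≡⟨ sumTo-cong (n / q) αterm-q* ⟩
    sumTo (n / q) (λ s → ifZero (v₂ s) 1 + αterm s)       ≡⟨ sumTo-+ (n / q) _ αterm ⟩
    oddCount (n / q) + α (n / q)                          ∎
    where
    open ≡-Reasoning
    αterm-vanishes : ∀ r → 1 ≤ r → ¬ q ∣ r → αterm r ≡ 0
    αterm-vanishes r 1≤r q∤r = trans (cong (ifZero (v₂ r)) (vq-vanishes 1≤r q∤r)) (ifZero-0 (v₂ r))
    αterm-q* : ∀ s → 1 ≤ s → αterm (q * s) ≡ ifZero (v₂ s) 1 + αterm s
    αterm-q* s 1≤s = trans (cong₂ ifZero (proj₁ (odd₂-q* 1≤s)) (vq-q* 1≤s)) (ifZero-suc (v₂ s) (vq s))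

  β-rec : ∀ n → β n ≡ excess (n / q) + β (n / q)
  β-rec n = begin
    β n                                                   ≡⟨ MultiplesOf.sum-multiples q βterm βterm-vanishes n ⟩
    sumTo (n / q) (λ s → βterm (q * s))                   ≡⟨ sumTo-cong (n / q) βterm-q* ⟩
    sumTo (n / q) (λ s → (v₂ s ∸ 1) + βterm s)            ≡⟨ sumTo-+ (n / q) _ βterm ⟩
    excess (n / q) + β (n / q)                            ∎
    where
    open ≡-Reasoning
    βterm-vanishes : ∀ r → 1 ≤ r → ¬ q ∣ r → βterm r ≡ 0
    βterm-vanishes r 1≤r q∤r = trans (cong ((v₂ r ∸ 1) *_) (vq-vanishes 1≤r q∤r)) (*-zeroʳ (v₂ r ∸ 1))
    βterm-q* : ∀ s → 1 ≤ s → βterm (q * s) ≡ (v₂ s ∸ 1) + βterm s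
    βterm-q* s 1≤s = trans (cong₂ (λ k v → (k ∸ 1) * v) (proj₁ (odd₂-q* 1≤s)) (vq-q* 1≤s)) (*-suc (v₂ s ∸ 1) (vq s))

  -- Unfolding the recurrences with excess ≤ oddCount: β n ≤ α n.
  β≤α : ∀ n → β n ≤ α n
  β≤α = <-rec (λ n → β n ≤ α n) step
    where
    step : ∀ n → (∀ {m} → m < n → β m ≤ α m) → β n ≤ α n
    step zero _ = z≤n
    step n@(suc _) ih = subst₂ _≤_ (sym (β-rec n)) (sym (α-rec n))
      (+-mono-≤ (excess≤oddCount (n / q)) (ih (m/n<m n q 2≤q)))

  -- Each of the first t unfoldings gains one, since ⌊n/q⌋ ≥ 1 while q ^ t ≤ n:
  -- t + v_q(Den n) ≤ v_q(Num n).
  t+β≤α : ∀ t n → q ^ t ≤ n → t + β n ≤ α n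
  t+β≤α zero n _ = β≤α n
  t+β≤α (suc t) n q^t+1≤n = subst₂ (λ b a → suc t + b ≤ a) (sym (β-rec n)) (sym (α-rec n)) (begin
    suc t + (excess m + β m)     ≡⟨ cong suc (+-leftComm t (excess m) (β m)) ⟩
    suc (excess m + (t + β m))   ≤⟨ +-mono-≤ (excess<oddCount m 1≤m) (t+β≤α t m q^t≤m) ⟩
    oddCount m + α m             ∎)
    where
    open ≤-Reasoning
    m = n / q
    q^t≤m : q ^ t ≤ m
    q^t≤m = subst (_≤ m) (m*n/n≡m (q ^ t) q) (/-monoˡ-≤ q (subst (_≤ n) (*-comm q (q ^ t)) q^t+1≤n))
    1≤m : 1 ≤ m
    1≤m = ≤-trans (1≤^ q t (≤-trans (s≤s z≤n) 2≤q)) q^t≤m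

∤⇒coprime : ∀ {p w} → Prime p → ¬ p ∣ w → Coprime w p
∤⇒coprime pr p∤w (d∣w , d∣p) with prime⇒irreducible pr d∣p
... | inj₁ d≡1 = d≡1
... | inj₂ refl = ⊥-elim (p∤w d∣w)

coprime-^-cancel : ∀ {w p} a c → Coprime w p → w ∣ p ^ a * c → w ∣ c
coprime-^-cancel {w} zero c _ w∣ = subst (w ∣_) (*-identityˡ c) w∣
coprime-^-cancel {w} {p} (suc a) c w⊥p w∣ =
  coprime-^-cancel a c w⊥p (coprime-divisor w⊥p (subst (w ∣_) (^-suc-* p a c) w∣))

∃prime∣ : ∀ x → 2 ≤ x → ∃[ p ] Prime p × p ∣ x
∃prime∣ (suc zero) (s≤s ())
∃prime∣ x@(suc (suc _)) _ with factorise x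
... | record { factors = [] ; isFactorisation = () }
... | record { factors = p ∷ ps ; isFactorisation = x≡ ; factorsPrime = p-prime ∷ _ } =
  p , p-prime , divides (foldr _*_ 1 ps) (trans x≡ (*-comm p (foldr _*_ 1 ps)))

-- x ∣ y as soon as every prime power dividing x divides y. By strong induction:
-- split off the full power of one prime p ∣ x, x = p ^ v * w with w < x coprime to p.
prime-powers⇒∣ : ∀ x y → 1 ≤ x → (∀ p s → Prime p → p ^ s ∣ x → p ^ s ∣ y) → x ∣ y
prime-powers⇒∣ x y = <-rec (λ x → 1 ≤ x → (∀ p s → Prime p → p ^ s ∣ x → p ^ s ∣ y) → x ∣ y) step x
  where
  step : ∀ x → (∀ {w} → w < x → 1 ≤ w → (∀ p s → Prime p → p ^ s ∣ w → p ^ s ∣ y) → w ∣ y) →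
    1 ≤ x → (∀ p s → Prime p → p ^ s ∣ x → p ^ s ∣ y) → x ∣ y
  step zero _ () _
  step (suc zero) _ _ _ = 1∣ y
  step x@(suc (suc _)) ih 1≤x powers∣y with ∃prime∣ x (s≤s (s≤s z≤n))
  ... | p , pr , p∣x = subst (_∣ y) (sym x≡) (subst (p ^ v * w ∣_) y≡ (*-monoʳ-∣ (p ^ v) w∣c))
    where
    2≤p = prime⇒2≤ pr
    v = val p x
    w = cofactor p x
    x≡ : x ≡ p ^ v * w
    x≡ = val-decomp 2≤p 1≤x
    1≤v : 1 ≤ v
    1≤v = ^∣⇒≤val 1 2≤p 1≤x (subst (_∣ x) (sym (*-identityʳ p)) p∣x)
    1<p^v : 1 < p ^ v
    1<p^v = ≤-trans 2≤p (subst (_≤ p ^ v) (*-identityʳ p) (^-monoʳ-≤ p {{2≤⇒nonZero 2≤p}} 1≤v))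
    w<x : w < x
    w<x = subst (w <_) (trans (*-comm w (p ^ v)) (sym x≡)) (m<m*n w (p ^ v) {{>-nonZero (1≤cofactor 2≤p 1≤x)}} 1<p^v)
    w∣y : w ∣ y
    w∣y = ih w<x (1≤cofactor 2≤p 1≤x) (λ q s q-prime q^s∣w → powers∣y q s q-prime (∣-trans q^s∣w (cofactor∣ 2≤p 1≤x)))
    p^v∣y : p ^ v ∣ y
    p^v∣y = powers∣y p v pr (^val∣ 2≤p 1≤x)
    c = quotient p^v∣y
    y≡ : p ^ v * c ≡ y
    y≡ = trans (*-comm (p ^ v) c) (sym (_∣_.equality p^v∣y))
    w∣c : w ∣ c
    w∣c = coprime-^-cancel v c (∤⇒coprime pr (cofactor-∤ 2≤p 1≤x)) (subst (w ∣_) (sym y≡) w∣y)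

-- (★): every odd k ≤ n satisfies k · Den n ∣ Num n. The prime 2 divides neither side;
-- an odd prime q has v_q(k · Den n) = v_q k + β n ≤ α n = v_q(Num n) since q ^ v_q k ≤ k ≤ n.
odd*Den∣Num : ∀ n k → 1 ≤ k → k ≤ n → ¬ 2 ∣ k → k * Den n ∣ Num n
odd*Den∣Num n k 1≤k k≤n k-odd = prime-powers⇒∣ (k * Den n) (Num n) 1≤kDen powers∣Num
  where
  1≤kDen = *-mono-≤ 1≤k (1≤Den n)
  powers∣Num : ∀ p s → Prime p → p ^ s ∣ k * Den n → p ^ s ∣ Num n
  powers∣Num p s pr p^s∣ with p ≟ 2
  powers∣Num p zero pr p^s∣ | yes refl = 1∣ Num n
  powers∣Num p (suc s) pr p^s∣ | yes refl with euclidsLemma k (Den n) prime[2] (∣-trans (m∣m*n (2 ^ s)) p^s∣)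
  ... | inj₁ 2∣k = ⊥-elim (k-odd 2∣k)
  ... | inj₂ 2∣Den = ⊥-elim (Den-odd n 2∣Den)
  powers∣Num p s pr p^s∣ | no p≢2 = ∣-trans (^-mono-∣ p s≤α) (subst (λ e → p ^ e ∣ Num n) (val-Num n) (^val∣ 2≤p (1≤Num n)))
    where
    open OddPrime p pr (odd-prime pr p≢2)
    2≤p = prime⇒2≤ pr
    p^vk≤n : p ^ val p k ≤ n
    p^vk≤n = ≤-trans (∣⇒≤ {{>-nonZero 1≤k}} (^val∣ 2≤p 1≤k)) k≤n
    s≤α : s ≤ α n
    s≤α = ≤-trans (subst (s ≤_) (trans (proj₁ (val-* pr 1≤k (1≤Den n))) (cong (val p k +_) (val-Den n)))
                                (^∣⇒≤val s 2≤p 1≤kDen p^s∣))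
                  (t+β≤α (val p k) n p^vk≤n)

Den∣Num : ∀ n → Den n ∣ Num n
Den∣Num zero = ∣-refl
Den∣Num (suc n) = subst (_∣ Num (suc n)) (*-identityˡ (Den (suc n)))
  (odd*Den∣Num (suc n) 1 ≤-refl (s≤s z≤n) (≥2∤1 2≤2))

N : ℕ → ℕ
N n = quotient (Den∣Num n)

Num≡N*Den : ∀ n → Num n ≡ N n * Den n
Num≡N*Den n = _∣_.equality (Den∣Num n)

∣⇒1≤ : ∀ {x y} → x ∣ y → 1 ≤ y → 1 ≤ x
∣⇒1≤ {zero} x∣y 1≤y = ⊥-elim (<⇒≢ (≤-trans 1≤y (≤-reflexive (0∣⇒≡0 x∣y))) refl)
∣⇒1≤ {suc _} _ _ = s≤s z≤n

1≤N : ∀ n → 1 ≤ N n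
1≤N n = ∣⇒1≤ (divides (Den n) (trans (Num≡N*Den n) (*-comm (N n) (Den n)))) (1≤Num n)

odd∣N : ∀ n k → 1 ≤ k → k ≤ n → ¬ 2 ∣ k → k ∣ N n
odd∣N n k 1≤k k≤n k-odd = *-cancelʳ-∣ (Den n) {{>-nonZero (1≤Den n)}}
  (subst (k * Den n ∣_) (Num≡N*Den n) (odd*Den∣Num n k 1≤k k≤n k-odd))

-- Every j ≤ n divides 2 ^ n · N n: its odd part divides N n and 2 ^ v₂ j ≤ j ≤ n.
∣2^n*N : ∀ n j → 1 ≤ j → j ≤ n → j ∣ 2 ^ n * N n
∣2^n*N n j 1≤j j≤n = subst (_∣ 2 ^ n * N n) (sym (val-decomp 2≤2 1≤j)) (*-pres-∣ (^-mono-∣ 2 v₂j≤n) odd₂j∣N)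
  where
  instance _ = >-nonZero 1≤j
  odd₂j∣N : odd₂ j ∣ N n
  odd₂j∣N = odd∣N n (odd₂ j) (1≤odd₂ 1≤j) (≤-trans (∣⇒≤ (cofactor∣ 2≤2 1≤j)) j≤n) (cofactor-∤ 2≤2 1≤j)
  v₂j≤n : v₂ j ≤ n
  v₂j≤n = ≤-trans (<⇒≤ (n<2^n (v₂ j))) (≤-trans (∣⇒≤ (^val∣ 2≤2 1≤j)) j≤n)

lcm-least-all : ∀ xs y → (∀ {x} → x ∈ xs → x ∣ y) → foldr lcm 1 xs ∣ y
lcm-least-all [] y _ = 1∣ y
lcm-least-all (x ∷ xs) y all∣ = lcm-least (all∣ (here refl)) (lcm-least-all xs y (λ x∈ → all∣ (there x∈)))

lcmUpTo∣2^n*N : ∀ n → lcmUpTo n ∣ 2 ^ n * N n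
lcmUpTo∣2^n*N n = lcm-least-all (map suc (upTo n)) (2 ^ n * N n) member∣
  where
  member∣ : ∀ {x} → x ∈ map suc (upTo n) → x ∣ 2 ^ n * N n
  member∣ x∈ with ∈-map⁻ suc x∈
  ... | i , i∈ , refl = ∣2^n*N n (suc i) (s≤s z≤n) (∈-upTo⁻ i∈)

oddPartAux-decomp : ∀ fuel x → 1 ≤ x → x ≤ fuel →
  ∃[ a ] x ≡ 2 ^ a * oddPartAux fuel x × ¬ 2 ∣ oddPartAux fuel x
oddPartAux-decomp zero x 1≤x x≤0 with ≤-antisym (≤-trans 1≤x x≤0) z≤n
... | ()
oddPartAux-decomp (suc fuel) x@(suc _) 1≤x x≤fuel with 2 ∣? x
... | no 2∤x = 0 , sym (*-identityˡ x) , 2∤x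
... | yes 2∣x = let a , half≡ , half-odd = ih in
  suc a , trans (sym 2*half≡x) (trans (cong (2 *_) half≡) (sym (^-suc-* 2 a (oddPartAux fuel (x / 2))))) , half-odd
  where
  2*half≡x : 2 * (x / 2) ≡ x
  2*half≡x = m*[n/m]≡n 2∣x
  1≤half : 1 ≤ x / 2
  1≤half = ∣⇒1≤ (divides 2 (sym 2*half≡x)) 1≤x
  ih = oddPartAux-decomp fuel (x / 2) 1≤half (≤-pred (≤-trans (m/n<m x 2 2≤2) x≤fuel))

-- odd(lcm(1,…,n)) divides N n: it is odd and divides 2 ^ n · N n.
oddPart-lcm∣N : ∀ n → oddPart (lcmUpTo n) ∣ N n
oddPart-lcm∣N n = coprime-^-cancel n (N n) (∤⇒coprime prime[2] oddPart-odd) (∣-trans (divides (2 ^ a) l≡) (lcmUpTo∣2^n*N n))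
  where
  1≤lcm : 1 ≤ lcmUpTo n
  1≤lcm = ∣⇒1≤ (lcmUpTo∣2^n*N n) (*-mono-≤ (1≤^ 2 n (s≤s z≤n)) (1≤N n))
  decomp = oddPartAux-decomp (lcmUpTo n) (lcmUpTo n) 1≤lcm ≤-refl
  a = proj₁ decomp
  l≡ = proj₁ (proj₂ decomp)
  oddPart-odd = proj₂ (proj₂ decomp)

/-cross : ∀ a c b d .{{_ : NonZero b}} .{{_ : NonZero d}} →
  a * d ≡ c * b → (ℤ.+ a) ℚ./ b ≡ (ℤ.+ c) ℚ./ d
/-cross a c (suc b) (suc d) ad≡cb = fromℚᵘ-cong {mkℚᵘ (ℤ.+ a) b} {mkℚᵘ (ℤ.+ c) d}
  (*≡* (trans (sym (pos-* a (suc d))) (trans (cong ℤ.+_ ad≡cb) (pos-* c (suc b)))))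

/-* : ∀ a c b d .{{_ : NonZero b}} .{{_ : NonZero d}} .{{_ : NonZero (b * d)}} →
  ((ℤ.+ a) ℚ./ b) ℚ.* ((ℤ.+ c) ℚ./ d) ≡ (ℤ.+ (a * c)) ℚ./ (b * d)
/-* a c (suc b) (suc d) = toℚᵘ-injective (begin
  toℚᵘ (a/b ℚ.* c/d)                      ≈⟨ toℚᵘ-homo-* a/b c/d ⟩
  toℚᵘ a/b ℚᵘ.* toℚᵘ c/d                  ≈⟨ ℚᵘP.*-cong (toℚᵘ-fromℚᵘ (mkℚᵘ (ℤ.+ a) b)) (toℚᵘ-fromℚᵘ (mkℚᵘ (ℤ.+ c) d)) ⟩
  mkℚᵘ (ℤ.+ a ℤ.* ℤ.+ c) bd-1              ≈⟨ *≡* (cong (ℤ._* ℤ.+ suc bd-1) (sym (pos-* a c))) ⟩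
  mkℚᵘ (ℤ.+ (a * c)) bd-1                  ≈⟨ toℚᵘ-fromℚᵘ _ ⟨
  toℚᵘ ((ℤ.+ (a * c)) ℚ./ (suc b * suc d)) ∎)
  where
  open ℚᵘP.≃-Reasoning
  a/b = (ℤ.+ a) ℚ./ suc b
  c/d = (ℤ.+ c) ℚ./ suc d
  bd-1 = d + b * suc d

foldr-*-init : ∀ xs c → foldr ℚ._*_ c xs ≡ foldr ℚ._*_ 1ℚ xs ℚ.* c
foldr-*-init [] c = sym (ℚP.*-identityˡ c)
foldr-*-init (x ∷ xs) c = trans (cong (x ℚ.*_) (foldr-*-init xs c)) (sym (ℚP.*-assoc x _ c))

prodUpTo-suc : ∀ f n → prodUpTo f (suc n) ≡ prodUpTo f n ℚ.* f (suc n)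
prodUpTo-suc f n = begin
  prodUpTo f (suc n)                         ≡⟨ cong (λ l → prodℚ (map F l)) (sym (upTo-∷ʳ n)) ⟩
  prodℚ (map F (upTo n ∷ʳ n))                ≡⟨ cong prodℚ (map-++ F (upTo n) (n ∷ [])) ⟩
  prodℚ (map F (upTo n) ∷ʳ F n)              ≡⟨ foldr-∷ʳ ℚ._*_ 1ℚ (F n) (map F (upTo n)) ⟩
  foldr ℚ._*_ (F n ℚ.* 1ℚ) (map F (upTo n))  ≡⟨ foldr-*-init (map F (upTo n)) _ ⟩
  prodUpTo f n ℚ.* (F n ℚ.* 1ℚ)              ≡⟨ cong (prodUpTo f n ℚ.*_) (ℚP.*-identityʳ (F n)) ⟩
  prodUpTo f n ℚ.* f (suc n)                 ∎
  where
  open ≡-Reasoning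
  F = λ i → f (suc i)

pow1-k≡ : ∀ k ℓ (1≤ℓ : 1 ≤ ℓ) → pow1-k ℓ k ≡ ((ℤ.+ numer k ℓ) ℚ./ (ℓ ^ (k ∸ 1))) {{>-nonZero (1≤^ ℓ (k ∸ 1) 1≤ℓ)}}
pow1-k≡ zero ℓ _ = refl
pow1-k≡ (suc j) (suc m) _ = refl

module ProductOf (f : ℕ → ℚ) (f-def : ∀ (k ℓ : ℕ) → ¬ (2 ∣ ℓ) → f (2 ^ k * ℓ) ≡ pow1-k ℓ k) where

  f≡num/den : ∀ r → (1≤r : 1 ≤ r) → f r ≡ ((ℤ.+ num r) ℚ./ den r) {{>-nonZero (1≤den r 1≤r)}}
  f≡num/den r 1≤r = trans (cong f (val-decomp 2≤2 1≤r))
    (trans (f-def (v₂ r) (odd₂ r) (cofactor-∤ 2≤2 1≤r)) (pow1-k≡ (v₂ r) (odd₂ r) (1≤odd₂ 1≤r)))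

  prodUpTo≡Num/Den : ∀ n → prodUpTo f n ≡ ((ℤ.+ Num n) ℚ./ Den n) {{>-nonZero (1≤Den n)}}
  prodUpTo≡Num/Den zero = refl
  prodUpTo≡Num/Den (suc n) = begin
    prodUpTo f (suc n)                                                 ≡⟨ prodUpTo-suc f n ⟩
    prodUpTo f n ℚ.* f (suc n)                                         ≡⟨ cong₂ ℚ._*_ (prodUpTo≡Num/Den n) (f≡num/den (suc n) 1≤1+n) ⟩
    ((ℤ.+ Num n) ℚ./ Den n) ℚ.* ((ℤ.+ num (suc n)) ℚ./ den (suc n))    ≡⟨ /-* (Num n) (num (suc n)) (Den n) (den (suc n)) ⟩
    (ℤ.+ Num (suc n)) ℚ./ Den (suc n)                                  ∎
    where
    open ≡-Reasoning
    1≤1+n : 1 ≤ suc n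
    1≤1+n = s≤s z≤n
    instance
      _ = >-nonZero (1≤Den n)
      _ = >-nonZero (1≤den (suc n) 1≤1+n)
      _ = >-nonZero (1≤Den (suc n))

  prodUpTo≡N : ∀ n → prodUpTo f n ≡ (ℤ.+ N n) ℚ./ 1
  prodUpTo≡N n = trans (prodUpTo≡Num/Den n) (/-cross (Num n) (N n) (Den n) 1 {{>-nonZero (1≤Den n)}} (trans (*-identityʳ (Num n)) (Num≡N*Den n)))

  multiple-of : ∀ n {L} → L ∣ N n → ∃[ z ] prodUpTo f n ≡ (z ℚ./ 1) ℚ.* ℕ→ℚ L
  multiple-of n {L} (divides c N≡cL) = ℤ.+ c , (begin
    prodUpTo f n                          ≡⟨ prodUpTo≡N n ⟩
    (ℤ.+ N n) ℚ./ 1                       ≡⟨ cong (λ x → (ℤ.+ x) ℚ./ 1) N≡cL ⟩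
    (ℤ.+ (c * L)) ℚ./ 1                   ≡⟨ /-* c L 1 1 ⟨
    ((ℤ.+ c) ℚ./ 1) ℚ.* ((ℤ.+ L) ℚ./ 1)  ∎)
    where open ≡-Reasoning

theorem2 : (f : ℕ → ℚ)
    → (∀ (k ℓ : ℕ) → ¬ (2 ∣ ℓ) → f (2 ^ k * ℓ) ≡ pow1-k ℓ k)
    → (n : ℕ) → 1 ≤ n
    → (∃[ z ] prodUpTo f n ≡ (z ℚ./ 1) ℚ.* ℕ→ℚ (oddPart (lcmUpTo n)))
    × (∀ (p : ℕ) → Prime p → p ≢ 2 → p ≤ n
    → ∃[ z ] prodUpTo f n ≡ (z ℚ./ 1) ℚ.* ℕ→ℚ p)
theorem2 f f-def n _ = multiple-of n (oddPart-lcm∣N n) , odd-prime-divides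
  where
  open ProductOf f f-def
  odd-prime-divides : ∀ p → Prime p → p ≢ 2 → p ≤ n → ∃[ z ] prodUpTo f n ≡ (z ℚ./ 1) ℚ.* ℕ→ℚ p
  odd-prime-divides p pr p≢2 p≤n = multiple-of n (odd∣N n p (≤-trans (s≤s z≤n) (prime⇒2≤ pr)) p≤n (odd-prime pr p≢2))
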